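{- Every shifted flag complex is balanced.
   Context: A simplicial complex is flag if every minimal non-face has exactly two elements. A simplicial complex on $n$ vertices is shifted if there is a labeling of its vertices by $1,\dots,n$ such that for every face $\{v_1,\dots,v_k\}$, replacing any $v_i$ by a vertex (not already in the face) with a smaller label yields again a face. A $d$-dimensional simplicial complex is balanced if its vertices can be colored with $d+1$ colors so that the vertices of every face receive pairwise distinct colors. -}

module Defs where

open import Data.Nat using (ℕ; suc; _≤_)
open import Data.Bool using (Bool; true)
open import Data.Fin using (Fin; _<_)
open import Data.Fin.Subset using (Subset; _∈_; _∉_; _⊆_; _⊂_; ⁅_⁆; ∣_∣; inside; outside)
open import Data.Fin.Permutation using (Permutation′; _⟨$⟩ʳ_)
open import Data.Vec using (_[_]≔_)
open import Data.Product using (Σ; ∃; _×_)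
open import Relation.Binary.PropositionalEquality using (_≡_)
open import Relation.Nullary using (¬_)

record SimplicialComplex (n : ℕ) : Set where
  field
    face?        : Subset n → Bool
    down-closed  : ∀ {σ τ} → σ ⊆ τ → face? τ ≡ true → face? σ ≡ true
    vertices     : ∀ (i : Fin n) → face? ⁅ i ⁆ ≡ true

open SimplicialComplex public

IsFace : ∀ {n} → SimplicialComplex n → Subset n → Set
IsFace K σ = face? K σ ≡ true

HasDimension : ∀ {n} → SimplicialComplex n → ℕ → Set
HasDimension K d =
  (∃ λ σ → IsFace K σ × ∣ σ ∣ ≡ suc d) × (∀ σ → IsFace K σ → ∣ σ ∣ ≤ suc d)

MinimalNonFace : ∀ {n} → SimplicialComplex n → Subset n → Set
MinimalNonFace K σ = ¬ IsFace K σ × (∀ τ → τ ⊂ σ → IsFace K τ)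

Flag : ∀ {n} → SimplicialComplex n → Set
Flag K = ∀ σ → MinimalNonFace K σ → ∣ σ ∣ ≡ 2

-- Shifted: there is a labeling (bijection) of the vertices by Fin n
-- (labels 1..n shifted to 0..n-1) such that for every face σ, every v ∈ σ
-- and every w ∉ σ with smaller label, (σ ∖ {v}) ∪ {w} is a face.
Shifted : ∀ {n} → SimplicialComplex n → Set
Shifted {n} K = Σ (Permutation′ n) λ lab →
  ∀ σ (v w : Fin n) → IsFace K σ → v ∈ σ → w ∉ σ → (lab ⟨$⟩ʳ w) < (lab ⟨$⟩ʳ v) →
    IsFace K ((σ [ v ]≔ outside) [ w ]≔ inside)

Balanced : ∀ {n} → SimplicialComplex n → ℕ → Set
Balanced {n} K d = Σ (Fin n → Fin (suc d)) λ c →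
  ∀ σ (u v : Fin n) → IsFace K σ → u ∈ σ → v ∈ σ → c u ≡ c v → u ≡ v

-- If ab is an edge with ℓ a < ℓ b,
-- shifting a and b downwards shows that b together with all vertices of label
-- at most ℓ a is a clique; K being flag, this is a face with ℓ a + 2 vertices,
-- so ℓ a < d. Hence no two vertices of label at least d are adjacent, and
-- colouring v by min (ℓ v) d is proper.
module Submission where

open import Defs
open import Data.Nat using (ℕ; zero; suc; _+_; _≤_; _<_; _⊓_; _≤?_; z≤n; s≤s)
open import Data.Nat.Properties
  using (≤-trans; ≤-pred; <⇒≱; ≤-<-trans; <-cmp; <⇒≤; <-irrefl; suc-injective;
         m≤n⇒m<n∨m≡n; m⊓n≤n; m≤n⇒m⊓n≡m; ⊓-pres-m<)
open import Data.Bool using (true)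
open import Data.Bool.Properties using (T-≡) renaming (_≟_ to _≟ᵇ_)
open import Data.Fin as F using (Fin; toℕ; fromℕ<; inject≤; _≟_)
import Data.Fin.Properties as Finₚ
open Finₚ using (toℕ-injective; toℕ-fromℕ<; toℕ-inject≤; toℕ<n)
open import Data.Fin.Subset using (Subset; _∈_; _∉_; _⊆_; _∪_; _-_; _⊂_; ⁅_⁆; ∣_∣; ⊥; inside; outside)
open import Data.Fin.Subset.Properties
  using (x∈⁅x⁆; x∈⁅y⁆⇒x≡y; x∈p∪q⁺; x∈p∪q⁻; ∪-comm; ∪-idem; ∪-identityˡ;
         x∈p∧x≢y⇒x∈p-y; x∈p⇒∣p-x∣<∣p∣; p⊂q⇒p⊆q)
open import Data.Fin.Subset.Induction using (⊂-wellFounded; Acc; acc)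
open import Data.Fin.Permutation using (Permutation′; _⟨$⟩ʳ_; _⟨$⟩ˡ_; inverseˡ; inverseʳ)
open import Data.Vec using ([]; _∷_; tabulate; _[_]≔_)
open import Data.Vec.Properties using (lookup∘tabulate; []=⇒lookup; lookup⇒[]=; []≔-updates; []≔-minimal)
open import Data.Product using (∃; ∃₂; _,_; proj₁; proj₂)
open import Data.Sum using (_⊎_; inj₁; inj₂)
open import Function using (_∘_; Injective; Equivalence)
open import Relation.Binary.Definitions using (tri<; tri≈; tri>)
open import Relation.Binary.PropositionalEquality using (_≡_; _≢_; refl; sym; trans; cong; subst; module ≡-Reasoning)
open ≡-Reasoning
open import Relation.Nullary using (yes; no; contradiction)
open import Relation.Nullary.Decidable using (⌊_⌋; toWitness; fromWitness)
import Relation.Unary as U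

∣p∣≡0⇒p≡⊥ : ∀ {n} {p : Subset n} → ∣ p ∣ ≡ 0 → p ≡ ⊥
∣p∣≡0⇒p≡⊥ {p = []}          _ = refl
∣p∣≡0⇒p≡⊥ {p = outside ∷ p} e = cong (outside ∷_) (∣p∣≡0⇒p≡⊥ e)

∣p∣≡1⇒p≡⁅x⁆ : ∀ {n} {p : Subset n} → ∣ p ∣ ≡ 1 → ∃ λ x → p ≡ ⁅ x ⁆
∣p∣≡1⇒p≡⁅x⁆ {p = inside ∷ p}  e = F.zero , cong (inside ∷_) (∣p∣≡0⇒p≡⊥ (suc-injective e))
∣p∣≡1⇒p≡⁅x⁆ {p = outside ∷ p} e with ∣p∣≡1⇒p≡⁅x⁆ {p = p} e
... | x , refl = F.suc x , refl

∣p∣≡2⇒p≡⁅x⁆∪⁅y⁆ : ∀ {n} {p : Subset n} → ∣ p ∣ ≡ 2 → ∃₂ λ x y → p ≡ ⁅ x ⁆ ∪ ⁅ y ⁆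
∣p∣≡2⇒p≡⁅x⁆∪⁅y⁆ {p = inside ∷ p} e with ∣p∣≡1⇒p≡⁅x⁆ {p = p} (suc-injective e)
... | y , refl = F.zero , F.suc y , cong (inside ∷_) (sym (∪-identityˡ ⁅ y ⁆))
∣p∣≡2⇒p≡⁅x⁆∪⁅y⁆ {p = outside ∷ p} e with ∣p∣≡2⇒p≡⁅x⁆∪⁅y⁆ {p = p} e
... | x , y , refl = F.suc x , F.suc y , refl

injective⇒≤∣p∣ : ∀ {m n} {f : Fin m → Fin n} (p : Subset n) →
  Injective _≡_ _≡_ f → (∀ i → f i ∈ p) → m ≤ ∣ p ∣
injective⇒≤∣p∣ {zero}          p _   _   = z≤n
injective⇒≤∣p∣ {suc m} {f = f} p inj f∈p =
  ≤-trans (s≤s (injective⇒≤∣p∣ (p - f F.zero) (Finₚ.suc-injective ∘ inj) f∘suc∈p-f0))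
          (x∈p⇒∣p-x∣<∣p∣ (f∈p F.zero))
  where
  f∘suc∈p-f0 : ∀ i → f (F.suc i) ∈ p - f F.zero
  f∘suc∈p-f0 i = x∈p∧x≢y⇒x∈p-y (f∈p (F.suc i)) (Finₚ.0≢1+n ∘ sym ∘ inj)

module _ {n} {P : Fin n → Set} (P? : U.Decidable P) where

  ∈-tabulate⁻ : ∀ {x} → x ∈ tabulate (⌊_⌋ ∘ P?) → P x
  ∈-tabulate⁻ {x} x∈ = toWitness {a? = P? x} (Equivalence.from T-≡
    (trans (sym (lookup∘tabulate (⌊_⌋ ∘ P?) x)) ([]=⇒lookup x∈)))

  ∈-tabulate⁺ : ∀ {x} → P x → x ∈ tabulate (⌊_⌋ ∘ P?)
  ∈-tabulate⁺ {x} px = lookup⇒[]= x _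
    (trans (lookup∘tabulate (⌊_⌋ ∘ P?) x) (Equivalence.to T-≡ (fromWitness {a? = P? x} px)))

module _ {n} (K : SimplicialComplex n) where

  Edge : Fin n → Fin n → Set
  Edge x y = IsFace K (⁅ x ⁆ ∪ ⁅ y ⁆)

  Clique : Subset n → Set
  Clique σ = ∀ {x y} → x ∈ σ → y ∈ σ → Edge x y

  edge-refl : ∀ x → Edge x x
  edge-refl x = subst (IsFace K) (sym (∪-idem ⁅ x ⁆)) (vertices K x)

  edge-sym : ∀ {x y} → Edge x y → Edge y x
  edge-sym {x} {y} = subst (IsFace K) (∪-comm ⁅ x ⁆ ⁅ y ⁆)

  pair⊆ : ∀ {σ : Subset n} {x y} → x ∈ σ → y ∈ σ → ⁅ x ⁆ ∪ ⁅ y ⁆ ⊆ σ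
  pair⊆ {x = x} {y} x∈σ y∈σ z∈ with x∈p∪q⁻ ⁅ x ⁆ ⁅ y ⁆ z∈
  ... | inj₁ z∈⁅x⁆ = subst (_∈ _) (sym (x∈⁅y⁆⇒x≡y x z∈⁅x⁆)) x∈σ
  ... | inj₂ z∈⁅y⁆ = subst (_∈ _) (sym (x∈⁅y⁆⇒x≡y y z∈⁅y⁆)) y∈σ

  face⇒clique : ∀ {σ : Subset n} → IsFace K σ → Clique σ
  face⇒clique σ∈K x∈σ y∈σ = down-closed K (pair⊆ x∈σ y∈σ) σ∈K

  clique-⊆ : ∀ {τ σ} → τ ⊆ σ → Clique σ → Clique τ
  clique-⊆ τ⊆σ σ-clique x∈τ y∈τ = σ-clique (τ⊆σ x∈τ) (τ⊆σ y∈τ)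

  -- Well-founded induction on ⊂: a clique that is not a face is a minimal
  -- non-face, hence a pair, hence an edge.
  flag-clique⇒face : Flag K → ∀ σ → Clique σ → IsFace K σ
  flag-clique⇒face flag σ = go σ (⊂-wellFounded σ)
    where
    go : ∀ σ → Acc _⊂_ σ → Clique σ → IsFace K σ
    go σ (acc rec) σ-clique with face? K σ ≟ᵇ true
    ... | yes σ∈K = σ∈K
    ... | no  σ∉K = pair-face (∣p∣≡2⇒p≡⁅x⁆∪⁅y⁆ (flag σ (σ∉K , proper-faces)))
      where
      proper-faces : ∀ τ → τ ⊂ σ → IsFace K τ
      proper-faces τ τ⊂σ = go τ (rec τ⊂σ) (clique-⊆ (p⊂q⇒p⊆q τ⊂σ) σ-clique)
      pair-face : (∃₂ λ x y → σ ≡ ⁅ x ⁆ ∪ ⁅ y ⁆) → IsFace K σ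
      pair-face (x , y , refl) = σ-clique (x∈p∪q⁺ (inj₁ (x∈⁅x⁆ x))) (x∈p∪q⁺ (inj₂ (x∈⁅x⁆ y)))

module ShiftedFlagComplex {n} (K : SimplicialComplex n) (shifted : Shifted K) where

  lab : Permutation′ n
  lab = proj₁ shifted

  ℓ : Fin n → ℕ
  ℓ v = toℕ (lab ⟨$⟩ʳ v)

  ℓ-injective : ∀ {u v} → ℓ u ≡ ℓ v → u ≡ v
  ℓ-injective e = trans (sym (inverseˡ lab)) (trans (cong (lab ⟨$⟩ˡ_) (toℕ-injective e)) (inverseˡ lab))

  label<⇒≢ : ∀ {u v} → ℓ u < ℓ v → u ≢ v
  label<⇒≢ ℓu<ℓv refl = <-irrefl refl ℓu<ℓv

  edge-shift : ∀ {u v w} → u ≢ v → Edge K u v → w ≢ v → ℓ w < ℓ u → Edge K w v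
  edge-shift {u} {v} {w} u≢v uv∈K w≢v ℓw<ℓu =
    down-closed K (pair⊆ K w∈ v∈) (proj₂ shifted _ u w uv∈K (x∈p∪q⁺ (inj₁ (x∈⁅x⁆ u))) w∉ ℓw<ℓu)
    where
    w≢u : w ≢ u
    w≢u = label<⇒≢ ℓw<ℓu
    w∉ : w ∉ ⁅ u ⁆ ∪ ⁅ v ⁆
    w∉ w∈ with x∈p∪q⁻ ⁅ u ⁆ ⁅ v ⁆ w∈
    ... | inj₁ w∈⁅u⁆ = w≢u (x∈⁅y⁆⇒x≡y u w∈⁅u⁆)
    ... | inj₂ w∈⁅v⁆ = w≢v (x∈⁅y⁆⇒x≡y v w∈⁅v⁆)
    w∈ : w ∈ ((⁅ u ⁆ ∪ ⁅ v ⁆) [ u ]≔ outside) [ w ]≔ inside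
    w∈ = []≔-updates _ w
    v∈ : v ∈ ((⁅ u ⁆ ∪ ⁅ v ⁆) [ u ]≔ outside) [ w ]≔ inside
    v∈ = []≔-minimal _ v w (w≢v ∘ sym)
           ([]≔-minimal _ v u (u≢v ∘ sym) (x∈p∪q⁺ (inj₂ (x∈⁅x⁆ v))))

  below-neighbour : ∀ {a b z} → Edge K a b → ℓ a < ℓ b → ℓ z ≤ ℓ a → Edge K z b
  below-neighbour {a} {b} {z} ab∈K ℓa<ℓb ℓz≤ℓa with m≤n⇒m<n∨m≡n ℓz≤ℓa
  ... | inj₁ ℓz<ℓa = edge-shift (label<⇒≢ ℓa<ℓb) ab∈K (label<⇒≢ (≤-<-trans ℓz≤ℓa ℓa<ℓb)) ℓz<ℓa
  ... | inj₂ ℓz≡ℓa = subst (λ x → Edge K x b) (sym (ℓ-injective ℓz≡ℓa)) ab∈K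

  labelledAtMost : ℕ → Subset n
  labelledAtMost k = tabulate (⌊_⌋ ∘ λ z → ℓ z ≤? k)

  Cone : Fin n → Fin n → Subset n
  Cone a b = labelledAtMost (ℓ a) ∪ ⁅ b ⁆

  ∈-Cone⁻ : ∀ {a b x} → x ∈ Cone a b → ℓ x ≤ ℓ a ⊎ x ≡ b
  ∈-Cone⁻ {a} {b} x∈ with x∈p∪q⁻ (labelledAtMost (ℓ a)) ⁅ b ⁆ x∈
  ... | inj₁ x∈≤ = inj₁ (∈-tabulate⁻ (λ z → ℓ z ≤? ℓ a) x∈≤)
  ... | inj₂ x∈⁅b⁆ = inj₂ (x∈⁅y⁆⇒x≡y b x∈⁅b⁆)

  cone-clique : ∀ {a b} → Edge K a b → ℓ a < ℓ b → Clique K (Cone a b)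
  cone-clique {a} {b} ab∈K ℓa<ℓb {x} {y} x∈ y∈ with ∈-Cone⁻ x∈ | ∈-Cone⁻ y∈
  ... | inj₂ refl | inj₂ refl = edge-refl K b
  ... | inj₁ ℓx≤ℓa | inj₂ refl = below-neighbour ab∈K ℓa<ℓb ℓx≤ℓa
  ... | inj₂ refl | inj₁ ℓy≤ℓa = edge-sym K (below-neighbour ab∈K ℓa<ℓb ℓy≤ℓa)
  ... | inj₁ ℓx≤ℓa | inj₁ ℓy≤ℓa with x ≟ y
  ...   | yes refl = edge-refl K x
  ...   | no x≢y = edge-shift (label<⇒≢ ℓy<ℓb ∘ sym) (edge-sym K (below-neighbour ab∈K ℓa<ℓb ℓy≤ℓa))
                     x≢y (≤-<-trans ℓx≤ℓa ℓa<ℓb)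
    where
    ℓy<ℓb : ℓ y < ℓ b
    ℓy<ℓb = ≤-<-trans ℓy≤ℓa ℓa<ℓb

  cone-size : ∀ {a b} → ℓ a < ℓ b → 2 + ℓ a ≤ ∣ Cone a b ∣
  cone-size {a} {b} ℓa<ℓb = injective⇒≤∣p∣ (Cone a b) f-injective f∈Cone
    where
    labelled : Fin (suc (ℓ a)) → Fin n
    labelled j = lab ⟨$⟩ˡ inject≤ j (toℕ<n (lab ⟨$⟩ʳ a))
    ℓ-labelled : ∀ j → ℓ (labelled j) ≡ toℕ j
    ℓ-labelled j = trans (cong toℕ (inverseʳ lab)) (toℕ-inject≤ j _)
    ℓ-labelled≤ℓa : ∀ j → ℓ (labelled j) ≤ ℓ a
    ℓ-labelled≤ℓa j = subst (_≤ ℓ a) (sym (ℓ-labelled j)) (≤-pred (toℕ<n j))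
    b≢labelled : ∀ j → b ≢ labelled j
    b≢labelled j b≡ = <⇒≱ ℓa<ℓb (subst (λ v → ℓ v ≤ ℓ a) (sym b≡) (ℓ-labelled≤ℓa j))
    f : Fin (2 + ℓ a) → Fin n
    f F.zero    = b
    f (F.suc j) = labelled j
    f-injective : Injective _≡_ _≡_ f
    f-injective {F.zero}  {F.zero}  _ = refl
    f-injective {F.zero}  {F.suc j} e = contradiction e (b≢labelled j)
    f-injective {F.suc i} {F.zero}  e = contradiction (sym e) (b≢labelled i)
    f-injective {F.suc i} {F.suc j} e =
      cong F.suc (toℕ-injective (trans (sym (ℓ-labelled i)) (trans (cong ℓ e) (ℓ-labelled j))))
    f∈Cone : ∀ i → f i ∈ Cone a b
    f∈Cone F.zero    = x∈p∪q⁺ (inj₂ (x∈⁅x⁆ b))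
    f∈Cone (F.suc j) = x∈p∪q⁺ (inj₁ (∈-tabulate⁺ (λ z → ℓ z ≤? ℓ a) (ℓ-labelled≤ℓa j)))

  module _ (flag : Flag K) {d} (dim : ∀ σ → IsFace K σ → ∣ σ ∣ ≤ suc d) where

    edge⇒lower-label<d : ∀ {a b} → Edge K a b → ℓ a < ℓ b → ℓ a < d
    edge⇒lower-label<d ab∈K ℓa<ℓb =
      ≤-pred (≤-trans (cone-size ℓa<ℓb) (dim _ (flag-clique⇒face K flag _ (cone-clique ab∈K ℓa<ℓb))))

    colour : Fin n → Fin (suc d)
    colour v = fromℕ< (s≤s (m⊓n≤n (ℓ v) d))

    edge⇒colour≢ : ∀ {u v} → Edge K u v → ℓ u < ℓ v → colour u ≢ colour v
    edge⇒colour≢ {u} {v} uv∈K ℓu<ℓv cu≡cv = <-irrefl ℓu≡ℓv⊓d (⊓-pres-m< ℓu<ℓv ℓu<d)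
      where
      ℓu<d : ℓ u < d
      ℓu<d = edge⇒lower-label<d uv∈K ℓu<ℓv
      ℓu≡ℓv⊓d : ℓ u ≡ ℓ v ⊓ d
      ℓu≡ℓv⊓d = begin
        ℓ u              ≡⟨ sym (m≤n⇒m⊓n≡m (<⇒≤ ℓu<d)) ⟩
        ℓ u ⊓ d          ≡⟨ sym (toℕ-fromℕ< _) ⟩
        toℕ (colour u)   ≡⟨ cong toℕ cu≡cv ⟩
        toℕ (colour v)   ≡⟨ toℕ-fromℕ< _ ⟩
        ℓ v ⊓ d          ∎

    balanced : Balanced K d
    balanced = colour , proper
      where
      proper : ∀ σ u v → IsFace K σ → u ∈ σ → v ∈ σ → colour u ≡ colour v → u ≡ v
      proper σ u v σ∈K u∈σ v∈σ cu≡cv with <-cmp (ℓ u) (ℓ v)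
      ... | tri< ℓu<ℓv _ _ = contradiction cu≡cv (edge⇒colour≢ (face⇒clique K σ∈K u∈σ v∈σ) ℓu<ℓv)
      ... | tri≈ _ ℓu≡ℓv _ = ℓ-injective ℓu≡ℓv
      ... | tri> _ _ ℓv<ℓu = contradiction (sym cu≡cv) (edge⇒colour≢ (face⇒clique K σ∈K v∈σ u∈σ) ℓv<ℓu)

mainTheorem3 : ∀ (n : ℕ) (K : SimplicialComplex n) (d : ℕ) →
    HasDimension K d → Shifted K → Flag K → Balanced K d
mainTheorem3 n K d (_ , dim) shifted flag = ShiftedFlagComplex.balanced K shifted flag dim
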